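{- Let $M$ be a square $\{0,1\}$-matrix with exactly $k$ diagonal entries equal to $0$ and exactly $\ell$ diagonal entries equal to $1$, where $k\ell>0$, and let $D$ be a minimal $M$-obstruction. If $D$ contains neither a pair of false twins nor a pair of true twins, then $|V(D)|\le (k+1)(\ell+1)$.
   Context: Digraphs are finite, without loops and multiple arcs. A strong clique: set $C$ with both $(x,y),(y,x)$ arcs for all distinct $x,y\in C$; an independent set: set with no arcs between any two of its vertices. For disjoint $S,S'$, $S$ is completely adjacent (resp. completely non-adjacent) to $S'$ if $(x,x')$ is an arc for all (resp. no) $x\in S,x'\in S'$. An $M$-partition of $D$ ($M$ of size $k+\ell$) is a partition of $V(D)$ into possibly empty parts $V_1,\dots,V_{k+\ell}$ with $V_i$ independent if $M(i,i)=0$, a strong clique if $M(i,i)=1$, and for $i\ne j$, $V_i$ completely non-adjacent to $V_j$ if $M(i,j)=0$ and completely adjacent to $V_j$ if $M(i,j)=1$. A minimal $M$-obstruction is a digraph with no $M$-partition such that $D-v$ has an $M$-partition for every vertex $v$. For distinct vertices $u,v,w$, $w$ distinguishes $u,v$ if exactly one of $u,v$ is an in-neighbour of $w$ or exactly one is an out-neighbour of $w$; distinct $u,v$ are twins if no vertex distinguishes them; true twins if moreover both $(u,v),(v,u)$ are arcs, false twins if neither is an arc. -}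

module Defs where

open import Data.Nat using (ℕ; zero; suc)
open import Data.Bool using (Bool; true; false; not)
open import Data.Fin using (Fin; punchIn)
open import Data.List using (length; filterᵇ; allFin)
open import Data.Product using (Σ; _×_; ∃; ∃-syntax)
open import Data.Sum using (_⊎_)
open import Relation.Nullary using (¬_)
open import Relation.Binary.PropositionalEquality using (_≡_; _≢_)

record Digraph (n : ℕ) : Set where
  field
    arc    : Fin n → Fin n → Bool
    noLoop : ∀ x → arc x x ≡ false
open Digraph public

-- A square {0,1}-matrix of size m (false = 0, true = 1).
Matrix01 : ℕ → Set
Matrix01 m = Fin m → Fin m → Bool

diagZeros : ∀ {m} → Matrix01 m → ℕ
diagZeros {m} M = length (filterᵇ (λ i → not (M i i)) (allFin m))

diagOnes : ∀ {m} → Matrix01 m → ℕ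
diagOnes {m} M = length (filterᵇ (λ i → M i i) (allFin m))

-- An M-partition, given as the assignment p of each vertex to its part
-- V_{p x}.  For distinct x,y in the same part i: independent (M i i = 0)
-- means no arc, strong clique (M i i = 1) means arc.  For x ∈ V_i, y ∈ V_j,
-- i ≠ j: arc (x,y) iff M i j = 1.  Uniformly: arc x y ≡ M (p x) (p y).
IsMPartition : ∀ {m n} → Matrix01 m → Digraph n → (Fin n → Fin m) → Set
IsMPartition M D p = ∀ x y → x ≢ y → arc D x y ≡ M (p x) (p y)

HasMPartition : ∀ {m n} → Matrix01 m → Digraph n → Set
HasMPartition {m} {n} M D = ∃[ p ] IsMPartition M D p

deleteVertex : ∀ {n} → Digraph (suc n) → Fin (suc n) → Digraph n
deleteVertex D v = record
  { arc    = λ x y → arc D (punchIn v x) (punchIn v y)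
  ; noLoop = λ x → noLoop D (punchIn v x) }

MinimalObstruction : ∀ {m n} → Matrix01 m → Digraph n → Set
MinimalObstruction {n = zero}  M D = ¬ HasMPartition M D
MinimalObstruction {n = suc n} M D =
  ¬ HasMPartition M D × (∀ v → HasMPartition M (deleteVertex D v))

Distinguishes : ∀ {n} → Digraph n → Fin n → Fin n → Fin n → Set
Distinguishes D w u v =
  u ≢ v × w ≢ u × w ≢ v ×
  ((arc D u w ≢ arc D v w) ⊎ (arc D w u ≢ arc D w v))

Twins : ∀ {n} → Digraph n → Fin n → Fin n → Set
Twins D u v = u ≢ v × (∀ w → ¬ Distinguishes D w u v)

TrueTwins : ∀ {n} → Digraph n → Fin n → Fin n → Set
TrueTwins D u v = Twins D u v × arc D u v ≡ true × arc D v u ≡ true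

FalseTwins : ∀ {n} → Digraph n → Fin n → Fin n → Set
FalseTwins D u v = Twins D u v × arc D u v ≡ false × arc D v u ≡ false

-- Let m = k + ℓ be the size of M and, for each vertex v, fix an M-partition
-- of D - v.  Without twins, partitions of D - u and D - v cannot agree much:
-- two vertices outside {u, v} sharing a part in both are seen alike by every
-- vertex, u and v included, so they would be twins.  Likewise two vertices
-- cannot share a part of D - v if v is adjacent to both as a member of one and
-- the same part would be.  Now take v, z sharing a part of D - u: every vertex
-- outside {u, v, z} sees v and z alike, hence sees v as a member of the part
-- of z in D - v.  If n > m + 3, two of these vertices share a part of D - v,
-- which is impossible; so n ≤ m + 3 ≤ (k + 1)(ℓ + 1) once kℓ ≥ 2.  When
-- k = ℓ = 1, two rounds of this argument, together with the fact that the two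
-- parts involved must then have different diagonal entries, give n ≤ 4.
module Submission where

open import Defs
open import Data.Nat using (ℕ; _+_; _*_; _≤_; _<_)
open import Data.Product using (∃-syntax)
open import Relation.Nullary using (¬_)
open import Relation.Binary.PropositionalEquality using (_≡_)

open import Data.Nat using (zero; suc; z≤n; s≤s)
import Data.Nat.Properties as ℕ
open import Data.Nat.Tactic.RingSolver using (solve-∀)
open import Data.Fin using (Fin; punchIn; punchOut; join; splitAt; _≟_)
import Data.Fin as Fin
import Data.Fin.Properties as Fin
open import Data.Bool using (Bool; true; false; not)
open import Data.List using (List; []; _∷_; length; filterᵇ; allFin)
import Data.List.Properties as List
open import Data.Vec using (Vec; []; _∷_; lookup)
open import Data.Vec.Relation.Unary.Any using (here; there; index)
open import Data.Vec.Relation.Unary.Any.Properties using (lookup-index)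
open import Data.Vec.Membership.Propositional using (_∈_; _∉_)
import Data.Vec.Membership.DecPropositional as DecMembership
open import Data.Product using (_×_; _,_; proj₁; proj₂)
open import Data.Sum using (_⊎_; inj₁; inj₂; [_,_]′)
open import Data.Sum.Properties using (inj₁-injective; inj₂-injective)
open import Data.Empty using (⊥; ⊥-elim)
open import Function using (_∘_)
open import Relation.Nullary using (Dec; yes; no; contradiction)
open import Relation.Binary.PropositionalEquality
  using (_≢_; refl; sym; trans; cong; cong₂; subst; ≢-sym; module ≡-Reasoning)

open ≡-Reasoning

length-filterᵇ-complement : ∀ {A : Set} (f : A → Bool) (xs : List A) →
  length (filterᵇ (not ∘ f) xs) + length (filterᵇ f xs) ≡ length xs
length-filterᵇ-complement f [] = refl
length-filterᵇ-complement f (x ∷ xs) with f x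
... | true  = trans (ℕ.+-suc _ _) (cong suc (length-filterᵇ-complement f xs))
... | false = cong suc (length-filterᵇ-complement f xs)

diagZeros+diagOnes : ∀ {m} (M : Matrix01 m) → diagZeros M + diagOnes M ≡ m
diagZeros+diagOnes {m} M =
  trans (length-filterᵇ-complement (λ i → M i i) (allFin m)) (List.length-tabulate (λ i → i))

c+[k+ℓ]≤[k+1]*[ℓ+1] : ∀ k ℓ {c} → c ≤ suc (k * ℓ) → c + (k + ℓ) ≤ (k + 1) * (ℓ + 1)
c+[k+ℓ]≤[k+1]*[ℓ+1] k ℓ c≤ =
  ℕ.≤-trans (ℕ.+-monoˡ-≤ (k + ℓ) c≤) (ℕ.≤-reflexive (sym (expand k ℓ)))
  where
    expand : ∀ k ℓ → (k + 1) * (ℓ + 1) ≡ suc (k * ℓ) + (k + ℓ)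
    expand = solve-∀

≢-unique-Fin2 : (x y z : Fin 2) → x ≢ y → z ≢ y → x ≡ z
≢-unique-Fin2 Fin.zero Fin.zero _ x≢y _ = contradiction refl x≢y
≢-unique-Fin2 (Fin.suc Fin.zero) (Fin.suc Fin.zero) _ x≢y _ = contradiction refl x≢y
≢-unique-Fin2 _ Fin.zero Fin.zero _ z≢y = contradiction refl z≢y
≢-unique-Fin2 _ (Fin.suc Fin.zero) (Fin.suc Fin.zero) _ z≢y = contradiction refl z≢y
≢-unique-Fin2 Fin.zero (Fin.suc Fin.zero) Fin.zero _ _ = refl
≢-unique-Fin2 (Fin.suc Fin.zero) Fin.zero (Fin.suc Fin.zero) _ _ = refl

record Collision {n m k} (avoid : Vec (Fin n) k) (P : Fin n → Fin m) : Set where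
  field
    x y      : Fin n
    x≢y      : x ≢ y
    x∉       : x ∉ avoid
    y∉       : y ∉ avoid
    samePart : P x ≡ P y

-- Vertices of the list get their own tag, so only two vertices outside it can share one.
collision : ∀ {n m k} (avoid : Vec (Fin n) k) (P : Fin n → Fin m) → k + m < n → Collision avoid P
collision {n} {m} {k} avoid P k+m<n =
  fromPigeon (Fin.pigeonhole k+m<n (join k m ∘ classify))
  where
    open DecMembership (_≟_ {n}) using (_∈?_)

    tag : (x : Fin n) → Dec (x ∈ avoid) → Fin k ⊎ Fin m
    tag x (yes x∈) = inj₁ (index x∈)
    tag x (no _)   = inj₂ (P x)

    classify : Fin n → Fin k ⊎ Fin m
    classify x = tag x (x ∈? avoid)

    join-injective : ∀ {i j} → join k m i ≡ join k m j → i ≡ j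
    join-injective {i} {j} eq = begin
      i                      ≡⟨ sym (Fin.splitAt-join k m i) ⟩
      splitAt k (join k m i) ≡⟨ cong (splitAt k) eq ⟩
      splitAt k (join k m j) ≡⟨ Fin.splitAt-join k m j ⟩
      j                      ∎

    fromTags : ∀ x y → x ≢ y → (x? : Dec (x ∈ avoid)) (y? : Dec (y ∈ avoid)) →
               tag x x? ≡ tag y y? → Collision avoid P
    fromTags x y x≢y (yes x∈) (yes y∈) eq = contradiction (begin
      x                       ≡⟨ lookup-index x∈ ⟩
      lookup avoid (index x∈) ≡⟨ cong (lookup avoid) (inj₁-injective eq) ⟩
      lookup avoid (index y∈) ≡⟨ sym (lookup-index y∈) ⟩
      y                       ∎) x≢y
    fromTags x y x≢y (yes _) (no _) ()
    fromTags x y x≢y (no _) (yes _) ()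
    fromTags x y x≢y (no x∉) (no y∉) eq =
      record { x = x ; y = y ; x≢y = x≢y ; x∉ = x∉ ; y∉ = y∉ ; samePart = inj₂-injective eq }

    fromPigeon : ∃[ x ] ∃[ y ] Fin._<_ x y × join k m (classify x) ≡ join k m (classify y) →
                 Collision avoid P
    fromPigeon (x , y , x<y , tags≡) =
      fromTags x y (Fin.<⇒≢ x<y) (x ∈? avoid) (y ∈? avoid) (join-injective tags≡)

-- An M-partition of D - v, read on Fin n: the part assigned to v itself is irrelevant.
record PartitionOff {m n} (M : Matrix01 m) (D : Digraph n) (v : Fin n) (P : Fin n → Fin m) : Set where
  constructor partitionOff
  field
    arc≡ : ∀ x y → x ≢ v → y ≢ v → x ≢ y → arc D x y ≡ M (P x) (P y)
open PartitionOff using (arc≡)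

PartitionsOff : ∀ {m n} → Matrix01 m → Digraph n → Set
PartitionsOff M D = ∀ v → ∃[ P ] PartitionOff M D v P

extendAt : ∀ {m n} → Fin (suc n) → Fin m → (Fin n → Fin m) → Fin (suc n) → Fin m
extendAt v i p w with v ≟ w
... | yes _  = i
... | no v≢w = p (punchOut v≢w)

extendAt-punchOut : ∀ {m n} v (i : Fin m) (p : Fin n → Fin m) {w} (v≢w : v ≢ w) →
                    extendAt v i p w ≡ p (punchOut v≢w)
extendAt-punchOut v i p {w} v≢w with v ≟ w
... | yes v≡w = contradiction v≡w v≢w
... | no _    = cong p (Fin.punchOut-cong v refl)

partitionOff-deleteVertex : ∀ {m n} {M : Matrix01 m} {D : Digraph (suc n)} {v} →
  Fin m → HasMPartition M (deleteVertex D v) → ∃[ P ] PartitionOff M D v P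
partitionOff-deleteVertex {M = M} {D} {v} i (p , p-ok) = extendAt v i p , partitionOff extended-ok
  where
    extended-ok : ∀ x y → x ≢ v → y ≢ v → x ≢ y → arc D x y ≡ M (extendAt v i p x) (extendAt v i p y)
    extended-ok x y x≢v y≢v x≢y = begin
      arc D x y
        ≡⟨ cong₂ (arc D) (sym (Fin.punchIn-punchOut v≢x)) (sym (Fin.punchIn-punchOut v≢y)) ⟩
      arc D (punchIn v (punchOut v≢x)) (punchIn v (punchOut v≢y))
        ≡⟨ p-ok _ _ (x≢y ∘ Fin.punchOut-injective v≢x v≢y) ⟩
      M (p (punchOut v≢x)) (p (punchOut v≢y))
        ≡⟨ sym (cong₂ M (extendAt-punchOut v i p v≢x) (extendAt-punchOut v i p v≢y)) ⟩
      M (extendAt v i p x) (extendAt v i p y) ∎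
      where
        v≢x = ≢-sym x≢v
        v≢y = ≢-sym y≢v

minimalObstruction⇒partitionsOff : ∀ {m n} {M : Matrix01 m} {D : Digraph n} →
  Fin m → MinimalObstruction M D → PartitionsOff M D
minimalObstruction⇒partitionsOff {n = zero}  _ _ ()
minimalObstruction⇒partitionsOff {n = suc _} {M} {D} i (_ , deletable) v =
  partitionOff-deleteVertex {M = M} {D} i (deletable v)

record SameArcsWith {n} (D : Digraph n) (w a b : Fin n) : Set where
  constructor sameArcs
  field
    toward : arc D a w ≡ arc D b w
    from   : arc D w a ≡ arc D w b

record Fits {m n} (M : Matrix01 m) (D : Digraph n) (P : Fin n → Fin m) (v : Fin n) (j : Fin m)
            (w : Fin n) : Set where
  constructor fits
  field
    toward : arc D v w ≡ M j (P w)
    from   : arc D w v ≡ M (P w) j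

sameArcs⇒twins : ∀ {n} {D : Digraph n} {a b} → a ≢ b →
  (∀ w → w ≢ a → w ≢ b → SameArcsWith D w a b) → Twins D a b
sameArcs⇒twins {D = D} {a} {b} a≢b same = a≢b , undistinguished
  where
    undistinguished : ∀ w → ¬ Distinguishes D w a b
    undistinguished w (_ , w≢a , w≢b , differs) with same w w≢a w≢b
    ... | sameArcs toward from = [ contradiction toward , contradiction from ]′ differs

module _ {m n} {M : Matrix01 m} {D : Digraph n} {u} {P : Fin n → Fin m}
         (P-ok : PartitionOff M D u P) where

  samePart⇒symmetric : ∀ {a b} → a ≢ u → b ≢ u → a ≢ b → P a ≡ P b → arc D a b ≡ arc D b a
  samePart⇒symmetric {a} {b} a≢u b≢u a≢b Pa≡Pb = begin
    arc D a b     ≡⟨ arc≡ P-ok a b a≢u b≢u a≢b ⟩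
    M (P a) (P b) ≡⟨ cong₂ M Pa≡Pb (sym Pa≡Pb) ⟩
    M (P b) (P a) ≡⟨ sym (arc≡ P-ok b a b≢u a≢u (≢-sym a≢b)) ⟩
    arc D b a     ∎

  samePart⇒sameArcs : ∀ {a b} → a ≢ u → b ≢ u → P a ≡ P b →
                      ∀ {w} → w ≢ u → w ≢ a → w ≢ b → SameArcsWith D w a b
  samePart⇒sameArcs {a} {b} a≢u b≢u Pa≡Pb {w} w≢u w≢a w≢b = sameArcs
    (begin
      arc D a w     ≡⟨ arc≡ P-ok a w a≢u w≢u (≢-sym w≢a) ⟩
      M (P a) (P w) ≡⟨ cong (λ i → M i (P w)) Pa≡Pb ⟩
      M (P b) (P w) ≡⟨ sym (arc≡ P-ok b w b≢u w≢u (≢-sym w≢b)) ⟩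
      arc D b w     ∎)
    (begin
      arc D w a     ≡⟨ arc≡ P-ok w a w≢u a≢u w≢a ⟩
      M (P w) (P a) ≡⟨ cong (M (P w)) Pa≡Pb ⟩
      M (P w) (P b) ≡⟨ sym (arc≡ P-ok w b w≢u b≢u w≢b) ⟩
      arc D w b     ∎)

  sameArcs⇒fits : ∀ {z w} → z ≢ u → w ≢ u → w ≢ z → SameArcsWith D w u z → Fits M D P u (P z) w
  sameArcs⇒fits {z} {w} z≢u w≢u w≢z (sameArcs toward from) =
    fits (trans toward (arc≡ P-ok z w z≢u w≢u (≢-sym w≢z))) (trans from (arc≡ P-ok w z w≢u z≢u w≢z))

  fits⇒sameArcs : ∀ {j a b} → P a ≡ P b → Fits M D P u j a → Fits M D P u j b → SameArcsWith D u a b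
  fits⇒sameArcs {j} Pa≡Pb (fits toward-a from-a) (fits toward-b from-b) = sameArcs
    (trans from-a (trans (cong (λ i → M i j) Pa≡Pb) (sym from-b)))
    (trans toward-a (trans (cong (M j) Pa≡Pb) (sym toward-b)))

module TwinFree {m n} {M : Matrix01 m} {D : Digraph n}
  (noFalseTwins : ¬ (∃[ u ] ∃[ v ] FalseTwins D u v))
  (noTrueTwins : ¬ (∃[ u ] ∃[ v ] TrueTwins D u v)) where

  symmetricTwins-absurd : ∀ {a b} → Twins D a b → arc D a b ≡ arc D b a → ⊥
  symmetricTwins-absurd {a} {b} twins symmetric with arc D a b in ab
  ... | true  = noTrueTwins (a , b , twins , ab , sym symmetric)
  ... | false = noFalseTwins (a , b , twins , ab , sym symmetric)

  samePartTwice-absurd : ∀ {u v P Q} → PartitionOff M D u P → PartitionOff M D v Q → u ≢ v →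
    ∀ {a b} → a ≢ u → a ≢ v → b ≢ u → b ≢ v → a ≢ b → P a ≡ P b → Q a ≡ Q b → ⊥
  samePartTwice-absurd {u} {v} P-ok Q-ok u≢v {a} {b} a≢u a≢v b≢u b≢v a≢b Pa≡Pb Qa≡Qb =
    symmetricTwins-absurd (sameArcs⇒twins a≢b same) (samePart⇒symmetric P-ok a≢u b≢u a≢b Pa≡Pb)
    where
      same : ∀ w → w ≢ a → w ≢ b → SameArcsWith D w a b
      same w w≢a w≢b with w ≟ u
      ... | yes refl = samePart⇒sameArcs Q-ok a≢v b≢v Qa≡Qb u≢v w≢a w≢b
      ... | no w≢u   = samePart⇒sameArcs P-ok a≢u b≢u Pa≡Pb w≢u w≢a w≢b

  fittingSamePart-absurd : ∀ {v P j} → PartitionOff M D v P →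
    ∀ {a b} → a ≢ v → b ≢ v → a ≢ b → P a ≡ P b → Fits M D P v j a → Fits M D P v j b → ⊥
  fittingSamePart-absurd {v} P-ok {a} {b} a≢v b≢v a≢b Pa≡Pb a-fits b-fits =
    symmetricTwins-absurd (sameArcs⇒twins a≢b same) (samePart⇒symmetric P-ok a≢v b≢v a≢b Pa≡Pb)
    where
      same : ∀ w → w ≢ a → w ≢ b → SameArcsWith D w a b
      same w w≢a w≢b with w ≟ v
      ... | yes refl = fits⇒sameArcs P-ok Pa≡Pb a-fits b-fits
      ... | no w≢v   = samePart⇒sameArcs P-ok a≢v b≢v Pa≡Pb w≢v w≢a w≢b

module Bounds {m n} {M : Matrix01 m} {D : Digraph n}
  (noFalseTwins : ¬ (∃[ u ] ∃[ v ] FalseTwins D u v))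
  (noTrueTwins : ¬ (∃[ u ] ∃[ v ] TrueTwins D u v))
  (partitionsOff : PartitionsOff M D) where

  open TwinFree {M = M} {D} noFalseTwins noTrueTwins

  part : Fin n → Fin n → Fin m
  part v = proj₁ (partitionsOff v)

  part-ok : ∀ v → PartitionOff M D v (part v)
  part-ok v = proj₂ (partitionsOff v)

  record Aligned (u v z : Fin n) : Set where
    field
      v≢u      : v ≢ u
      z≢u      : z ≢ u
      v≢z      : v ≢ z
      samePart : part u v ≡ part u z

  aligned : ∀ {u} (c : Collision (u ∷ []) (part u)) → Aligned u (Collision.x c) (Collision.y c)
  aligned c = record { v≢u = x∉ ∘ here ; z≢u = y∉ ∘ here ; v≢z = x≢y ; samePart = samePart }
    where open Collision c

  -- v and z are alike for every w outside {u, v, z}, and z sits in part (part v z) off v.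
  aligned⇒fits : ∀ {u v z} → Aligned u v z →
                 ∀ {w} → w ≢ u → w ≢ v → w ≢ z → Fits M D (part v) v (part v z) w
  aligned⇒fits {u} {v} {z} a w≢u w≢v w≢z =
    sameArcs⇒fits (part-ok v) z≢v w≢v w≢z
      (samePart⇒sameArcs (part-ok u) v≢u z≢u samePart w≢u w≢v w≢z)
    where
      open Aligned a
      z≢v = ≢-sym v≢z

  record Mate (u v z : Fin n) : Set where
    field
      w        : Fin n
      w≢u      : w ≢ u
      w≢v      : w ≢ v
      w≢z      : w ≢ z
      samePart : part v w ≡ part v z

  mate : ∀ {u v z} → 2 + m < n → Aligned u v z → Mate u v z
  mate {u} {v} {z} lt a with collision (v ∷ u ∷ []) (part v) lt
  ... | record { x = x ; y = y ; x≢y = x≢y ; x∉ = x∉ ; y∉ = y∉ ; samePart = xy } with x ≟ z | y ≟ z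
  ... | yes x≡z | _ = record
    { w = y ; w≢u = y∉ ∘ there ∘ here ; w≢v = y∉ ∘ here
    ; w≢z = λ y≡z → x≢y (trans x≡z (sym y≡z)) ; samePart = trans (sym xy) (cong (part v) x≡z) }
  ... | no _ | yes y≡z = record
    { w = x ; w≢u = x∉ ∘ there ∘ here ; w≢v = x∉ ∘ here
    ; w≢z = λ x≡z → x≢y (trans x≡z (sym y≡z)) ; samePart = trans xy (cong (part v) y≡z) }
  ... | no x≢z | no y≢z = ⊥-elim (fittingSamePart-absurd (part-ok v) (x∉ ∘ here) (y∉ ∘ here) x≢y xy
    (aligned⇒fits a (x∉ ∘ there ∘ here) (x∉ ∘ here) x≢z)
    (aligned⇒fits a (y∉ ∘ there ∘ here) (y∉ ∘ here) y≢z))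

  mate-aligned : ∀ {u v z} → Aligned u v z → (w : Mate u v z) → Aligned v z (Mate.w w)
  mate-aligned a w = record
    { v≢u = ≢-sym (Aligned.v≢z a) ; z≢u = W.w≢v ; v≢z = ≢-sym W.w≢z ; samePart = sym W.samePart }
    where module W = Mate w

  mate-otherPart : ∀ {u v z} → Aligned u v z → (w : Mate u v z) → part u (Mate.w w) ≢ part u v
  mate-otherPart {u} {v} {z} a w uw≡uv =
    samePartTwice-absurd (part-ok u) (part-ok v) (≢-sym v≢u) z≢u (≢-sym v≢z) W.w≢u W.w≢v (≢-sym W.w≢z)
      (trans (sym samePart) (sym uw≡uv)) (sym W.samePart)
    where
      open Aligned a
      module W = Mate w

  -- Otherwise z would fit v at part (part v z) as well, next to its mate.
  mate-diagonal≢ : ∀ {u v z} → Aligned u v z → Mate u v z →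
                   M (part v z) (part v z) ≢ M (part u v) (part u v)
  mate-diagonal≢ {u} {v} {z} a w diag≡ =
    fittingSamePart-absurd (part-ok v) (≢-sym v≢z) W.w≢v (≢-sym W.w≢z) (sym W.samePart)
      (fits (via-u v≢u z≢u v≢z refl (sym samePart)) (via-u z≢u v≢u (≢-sym v≢z) (sym samePart) refl))
      (aligned⇒fits a W.w≢u W.w≢v W.w≢z)
    where
      open Aligned a
      module W = Mate w
      via-u : ∀ {x y} → x ≢ u → y ≢ u → x ≢ y → part u x ≡ part u v → part u y ≡ part u v →
              arc D x y ≡ M (part v z) (part v z)
      via-u {x} {y} x≢u y≢u x≢y ux uy =
        trans (arc≡ (part-ok u) x y x≢u y≢u x≢y) (trans (cong₂ M ux uy) (sym diag≡))

  ¬large : 3 + m < n → ⊥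
  ¬large lt = fittingSamePart-absurd (part-ok v) (C.x∉ ∘ here) (C.y∉ ∘ here) C.x≢y C.samePart
                (outside⇒fits C.x∉) (outside⇒fits C.y∉)
    where
      u : Fin n
      u = Fin.fromℕ< (ℕ.≤-trans (s≤s z≤n) lt)
      c : Collision (u ∷ []) (part u)
      c = collision (u ∷ []) (part u) (ℕ.m+n≤o⇒n≤o 2 lt)
      v = Collision.x c
      z = Collision.y c
      module C = Collision (collision (v ∷ u ∷ z ∷ []) (part v) lt)
      outside⇒fits : ∀ {w} → w ∉ v ∷ u ∷ z ∷ [] → Fits M D (part v) v (part v z) w
      outside⇒fits w∉ = aligned⇒fits (aligned c) (w∉ ∘ there ∘ here) (w∉ ∘ here) (w∉ ∘ there ∘ there ∘ here)

  bound : n ≤ 3 + m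
  bound = ℕ.≮⇒≥ ¬large

  -- With only two parts, the diagonal inequalities of two successive mates pin down every part
  -- involved, and the arcs w → z and w → w₂ then force M j j ≡ M c c.
  ¬large₂ : m ≡ 2 → 2 + m < n → ⊥
  ¬large₂ m≡2 lt = mate-diagonal≢ a W (begin
    M j j                      ≡⟨ cong (λ i → M i j) (sym W.samePart) ⟩
    M (part v w) j             ≡⟨ sym (arc≡ (part-ok v) w z W.w≢v (≢-sym v≢z) W.w≢z) ⟩
    arc D w z                  ≡⟨ arc≡ (part-ok u) w z W.w≢u z≢u W.w≢z ⟩
    M (part u w) (part u z)    ≡⟨ cong₂ M uw≡j (sym samePart) ⟩
    M j c                      ≡⟨ cong₂ M (sym W.samePart) (sym vw₂≡c) ⟩
    M (part v w) (part v w₂)   ≡⟨ sym (arc≡ (part-ok v) w w₂ W.w≢v W₂.w≢u (≢-sym W₂.w≢z)) ⟩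
    arc D w w₂                 ≡⟨ arc≡ (part-ok z) w w₂ W.w≢z W₂.w≢v (≢-sym W₂.w≢z) ⟩
    M (part z w) (part z w₂)   ≡⟨ cong₂ M zw≡c (trans W₂.samePart zw≡c) ⟩
    M c c                      ∎)
    where
      u : Fin n
      u = Fin.fromℕ< (ℕ.≤-trans (s≤s z≤n) lt)
      c₀ : Collision (u ∷ []) (part u)
      c₀ = collision (u ∷ []) (part u) (ℕ.m+n≤o⇒n≤o 1 lt)
      v = Collision.x c₀
      z = Collision.y c₀
      a = aligned c₀
      open Aligned a
      W = mate lt a
      module W = Mate W
      w = W.w
      a′ = mate-aligned a W
      W₂ = mate lt a′
      module W₂ = Mate W₂
      w₂ = W₂.w
      c = part u v
      j = part v z
      two-valued : (x y y′ : Fin m) → x ≢ y → y′ ≢ y → x ≡ y′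
      two-valued = subst (λ k → (x y y′ : Fin k) → x ≢ y → y′ ≢ y → x ≡ y′) (sym m≡2) ≢-unique-Fin2
      j≢c : j ≢ c
      j≢c j≡c = mate-diagonal≢ a W (cong₂ M j≡c j≡c)
      zw≡c : part z w ≡ c
      zw≡c = two-valued (part z w) j c (λ e → mate-diagonal≢ a′ W₂ (cong₂ M e e)) (j≢c ∘ sym)
      uw≡j : part u w ≡ j
      uw≡j = two-valued (part u w) c j (mate-otherPart a W) j≢c
      vw₂≡c : part v w₂ ≡ c
      vw₂≡c = two-valued (part v w₂) j c (mate-otherPart a′ W₂) (j≢c ∘ sym)

  bound₂ : m ≡ 2 → n ≤ 2 + m
  bound₂ m≡2 = ℕ.≮⇒≥ (¬large₂ m≡2)

someIndex : ∀ k ℓ {m} → 0 < k * ℓ → k + ℓ ≡ m → Fin m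
someIndex (suc k) ℓ _ refl = Fin.zero

lemma4 : (m : ℕ) (M : Matrix01 m) (k ℓ : ℕ) →
         diagZeros M ≡ k → diagOnes M ≡ ℓ → 0 < k * ℓ →
         (n : ℕ) (D : Digraph n) → MinimalObstruction M D →
         ¬ (∃[ u ] ∃[ v ] FalseTwins D u v) →
         ¬ (∃[ u ] ∃[ v ] TrueTwins D u v) →
         n ≤ (k + 1) * (ℓ + 1)
lemma4 m M k ℓ zeros ones kℓ>0 n D minimal noFalseTwins noTrueTwins =
  [ (λ 1<kℓ → via 3 bound (s≤s 1<kℓ))
  , (λ 1≡kℓ → via 2 (bound₂ (m≡2 (sym 1≡kℓ))) (s≤s kℓ>0))
  ]′ (ℕ.m≤n⇒m<n∨m≡n kℓ>0)
  where
    k+ℓ≡m : k + ℓ ≡ m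
    k+ℓ≡m = trans (cong₂ _+_ (sym zeros) (sym ones)) (diagZeros+diagOnes M)

    open Bounds noFalseTwins noTrueTwins
      (minimalObstruction⇒partitionsOff (someIndex k ℓ kℓ>0 k+ℓ≡m) minimal)

    via : ∀ c → n ≤ c + m → c ≤ suc (k * ℓ) → n ≤ (k + 1) * (ℓ + 1)
    via c n≤c+m c≤ =
      ℕ.≤-trans (subst (λ x → n ≤ c + x) (sym k+ℓ≡m) n≤c+m) (c+[k+ℓ]≤[k+1]*[ℓ+1] k ℓ c≤)

    m≡2 : k * ℓ ≡ 1 → m ≡ 2
    m≡2 kℓ≡1 = trans (sym k+ℓ≡m) (cong₂ _+_ (ℕ.m*n≡1⇒m≡1 k ℓ kℓ≡1) (ℕ.m*n≡1⇒n≡1 k ℓ kℓ≡1))
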